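{- Let $\Gamma[\Delta]$ be a nested sequent. Then there exists a nested sequent $\Gamma'$ such that $\Gamma[\Delta]$ is derivable from the nested sequent $\Gamma',\Delta$, and $\Gamma',\Delta$ is derivable from $\Gamma[\Delta]$, using only the residuation rule $r$.
   Context: $\Sigma$ is an alphabet with involution $a\mapsto\bar a$. A nested sequent is a finite multiset of formulae and structures $a\{\Delta\}$ ($a\in\Sigma$, $\Delta$ a nested sequent); comma denotes multiset union. A context $\Gamma[\ ]$ is a nested sequent with one hole in place of a formula, and $\Gamma[\Delta]$ is the result of replacing the hole by the nested sequent $\Delta$. The residuation rule $r$ derives $\bar a\{\Gamma\},\Delta$ from $\Gamma,a\{\Delta\}$ (for nested sequents $\Gamma,\Delta$ and $a\in\Sigma$). -}

module Defs where

open import Data.List using (List; []; _∷_; _++_)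

-- A nested sequent is a finite list of items, considered up to the
-- multiset equality _≈ₛ_ below (permutation at every nesting level).
mutual
  data Item (Σ Fm : Set) : Set where
    fm  : Fm → Item Σ Fm
    box : Σ → Seq Σ Fm → Item Σ Fm      -- a{Δ}

  Seq : (Σ Fm : Set) → Set
  Seq Σ Fm = List (Item Σ Fm)

mutual
  data _≈ᵢ_ {Σ Fm : Set} : Item Σ Fm → Item Σ Fm → Set where
    fm-eq  : ∀ {A} → fm A ≈ᵢ fm A
    box-eq : ∀ {a Δ Δ'} → Δ ≈ₛ Δ' → box a Δ ≈ᵢ box a Δ'

  data _≈ₛ_ {Σ Fm : Set} : Seq Σ Fm → Seq Σ Fm → Set where
    nil   : [] ≈ₛ []
    cons  : ∀ {i j xs ys} → i ≈ᵢ j → xs ≈ₛ ys → (i ∷ xs) ≈ₛ (j ∷ ys)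
    swap  : ∀ {i j xs} → (i ∷ j ∷ xs) ≈ₛ (j ∷ i ∷ xs)
    trans : ∀ {xs ys zs} → xs ≈ₛ ys → ys ≈ₛ zs → xs ≈ₛ zs

-- Contexts Γ[ ]: a nested sequent with exactly one hole (at any depth).
-- here S       represents   [ ] , S
-- inBox S a C  represents   a{C} , S
data Ctx (Σ Fm : Set) : Set where
  here  : Seq Σ Fm → Ctx Σ Fm
  inBox : Seq Σ Fm → Σ → Ctx Σ Fm → Ctx Σ Fm

plug : {Σ Fm : Set} → Ctx Σ Fm → Seq Σ Fm → Seq Σ Fm
plug (here S)      Δ = Δ ++ S
plug (inBox S a C) Δ = box a (plug C Δ) ∷ S

-- Derivability using only the residuation rule r (applied at the root,
-- sequents taken up to multiset equality):
--   Derives bar S T  means  T is derivable from S using r only, where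
--   r derives  ā{Γ},Δ  from  Γ,a{Δ}.
data Derives {Σ Fm : Set} (bar : Σ → Σ) : Seq Σ Fm → Seq Σ Fm → Set where
  done : ∀ {S T} → S ≈ₛ T → Derives bar S T
  r    : ∀ {S T} (Γ Δ : Seq Σ Fm) (a : Σ) →
         S ≈ₛ (Γ ++ (box a Δ ∷ [])) →
         Derives bar (box (bar a) Γ ∷ Δ) T →
         Derives bar S T

-- Residuation moves a whole box to the other side of the sequent: from
-- Γ, a{Δ} it gives ā{Γ}, Δ, and (since ā̄ = a) it can be undone, so the two
-- sequents are interderivable.  Peeling off the boxes on the path to the hole
-- one by one, each time residuating the rest of the current level into a new
-- outer box, brings Δ to the root and leaves Γ' as everything else.
module Submission where

open import Defs
open import Data.List using ([]; _∷_; _++_)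
open import Data.List.Properties using (++-assoc; ++-identityʳ)
open import Data.Product using (Σ-syntax; _×_; _,_)
open import Relation.Binary.PropositionalEquality using (_≡_; refl; sym; subst)

module _ {A Fm : Set} where

  mutual
    ≈ᵢ-refl : (i : Item A Fm) → i ≈ᵢ i
    ≈ᵢ-refl (fm _)    = fm-eq
    ≈ᵢ-refl (box _ Δ) = box-eq (≈ₛ-refl Δ)

    ≈ₛ-refl : (xs : Seq A Fm) → xs ≈ₛ xs
    ≈ₛ-refl []       = nil
    ≈ₛ-refl (x ∷ xs) = cons (≈ᵢ-refl x) (≈ₛ-refl xs)

  mutual
    ≈ᵢ-sym : {i j : Item A Fm} → i ≈ᵢ j → j ≈ᵢ i
    ≈ᵢ-sym fm-eq      = fm-eq
    ≈ᵢ-sym (box-eq p) = box-eq (≈ₛ-sym p)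

    ≈ₛ-sym : {xs ys : Seq A Fm} → xs ≈ₛ ys → ys ≈ₛ xs
    ≈ₛ-sym nil         = nil
    ≈ₛ-sym (cons p q)  = cons (≈ᵢ-sym p) (≈ₛ-sym q)
    ≈ₛ-sym swap        = swap
    ≈ₛ-sym (trans p q) = trans (≈ₛ-sym q) (≈ₛ-sym p)

  ≡⇒≈ₛ : {xs ys : Seq A Fm} → xs ≡ ys → xs ≈ₛ ys
  ≡⇒≈ₛ {xs} refl = ≈ₛ-refl xs

  ++⁺ˡ : (xs : Seq A Fm) {ys zs : Seq A Fm} → ys ≈ₛ zs → (xs ++ ys) ≈ₛ (xs ++ zs)
  ++⁺ˡ []       p = p
  ++⁺ˡ (x ∷ xs) p = cons (≈ᵢ-refl x) (++⁺ˡ xs p)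

  ∷-++-shift : (x : Item A Fm) (xs ys : Seq A Fm) → (x ∷ xs ++ ys) ≈ₛ (xs ++ x ∷ ys)
  ∷-++-shift x []       ys = ≈ₛ-refl _
  ∷-++-shift x (y ∷ xs) ys = trans swap (cons (≈ᵢ-refl y) (∷-++-shift x xs ys))

  ++-comm : (xs ys : Seq A Fm) → (xs ++ ys) ≈ₛ (ys ++ xs)
  ++-comm []       ys = ≡⇒≈ₛ (sym (++-identityʳ ys))
  ++-comm (x ∷ xs) ys = trans (cons (≈ᵢ-refl x) (++-comm xs ys)) (∷-++-shift x ys xs)

  module _ (bar : A → A) where

    Derives-resp-≈ˡ : {S S' T : Seq A Fm} → S' ≈ₛ S → Derives bar S T → Derives bar S' T
    Derives-resp-≈ˡ e (done p)      = done (trans e p)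
    Derives-resp-≈ˡ e (r Γ Δ a p d) = r Γ Δ a (trans e p) d

    Derives-trans : {S T U : Seq A Fm} → Derives bar S T → Derives bar T U → Derives bar S U
    Derives-trans (done p)      d' = Derives-resp-≈ˡ p d'
    Derives-trans (r Γ Δ a p d) d' = r Γ Δ a p (Derives-trans d d')

    Interderivable : Seq A Fm → Seq A Fm → Set
    Interderivable S T = Derives bar S T × Derives bar T S

    ≈⇒Interderivable : {S T : Seq A Fm} → S ≈ₛ T → Interderivable S T
    ≈⇒Interderivable e = done e , done (≈ₛ-sym e)

    Interderivable-sym : {S T : Seq A Fm} → Interderivable S T → Interderivable T S
    Interderivable-sym (f , b) = b , f

    Interderivable-trans : {S T U : Seq A Fm} →
                           Interderivable S T → Interderivable T U → Interderivable S U
    Interderivable-trans (f , b) (f' , b') = Derives-trans f f' , Derives-trans b' b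

    residuation : (∀ a → bar (bar a) ≡ a) → (Γ Δ : Seq A Fm) (a : A) →
                  Interderivable (Γ ++ box a Δ ∷ []) (box (bar a) Γ ∷ Δ)
    residuation inv Γ Δ a =
        r Γ Δ a (≈ₛ-refl _) (done (≈ₛ-refl _))
      , r Δ Γ (bar a) (++-comm (box (bar a) Γ ∷ []) Δ) (done unresiduated)
      where
      unresiduated : (box (bar (bar a)) Δ ∷ Γ) ≈ₛ (Γ ++ box a Δ ∷ [])
      unresiduated = subst (λ b → (box b Δ ∷ Γ) ≈ₛ (Γ ++ box a Δ ∷ []))
                           (sym (inv a)) (++-comm (box a Δ ∷ []) Γ)

    -- R collects what has already been residuated around the current level.
    hole-to-root : (∀ a → bar (bar a) ≡ a) → (C : Ctx A Fm) (Δ R : Seq A Fm) →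
                   Σ[ Γ' ∈ Seq A Fm ] Interderivable (Γ' ++ Δ) (R ++ plug C Δ)
    hole-to-root inv (here S) Δ R =
      R ++ S , ≈⇒Interderivable
                 (trans (≡⇒≈ₛ (++-assoc R S Δ)) (++⁺ˡ R (++-comm S Δ)))
    hole-to-root inv (inBox S a C) Δ R
      with hole-to-root inv C Δ (box (bar a) (R ++ S) ∷ [])
    ... | Γ' , Γ'++Δ⇔inner = Γ' , Interderivable-trans Γ'++Δ⇔inner (Interderivable-sym outer⇔inner)
      where
      X = plug C Δ
      outer⇔inner : Interderivable (R ++ box a X ∷ S) (box (bar a) (R ++ S) ∷ X)
      outer⇔inner = Interderivable-trans
        (≈⇒Interderivable (trans (++⁺ˡ R (++-comm (box a X ∷ []) S))
                                 (≡⇒≈ₛ (sym (++-assoc R S _)))))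
        (residuation inv (R ++ S) X a)

lemma3p3 : {A Fm : Set} (bar : A → A) → (∀ a → bar (bar a) ≡ a) →
    (Γ : Ctx A Fm) (Δ : Seq A Fm) →
    Σ[ Γ' ∈ Seq A Fm ]
    (Derives bar (Γ' ++ Δ) (plug Γ Δ) × Derives bar (plug Γ Δ) (Γ' ++ Δ))
lemma3p3 bar inv Γ Δ = hole-to-root bar inv Γ Δ []
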